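{- Let $a_2 \geq 3$ be an integer. The pair $(2,a_2)$ is a best 2-term Egyptian underapproximation sequence of $\theta$ for all $\theta$ in the interval \[ J(2,a_2) = \left( \frac{1}{2} + \frac{1}{a_2},\ \frac{1}{2} + \frac{1}{a_2 - 1} \right]. \] Moreover, with $J(2,6) = \left(\frac{2}{3}, \frac{7}{10}\right]$, $J(2,12) = \left(\frac{7}{12}, \frac{13}{22}\right]$, $J(2,30) = \left(\frac{8}{15}, \frac{31}{58}\right]$: (i) for all $\theta \in J(2,6)$, the pairs $(2,6)$ and $(3,3)$ are best 2-term underapproximation sequences of $\theta$, and they are the only ones; (ii) for all $\theta \in J(2,12)$, the pairs $(2,12)$ and $(3,4)$ are best 2-term underapproximation sequences of $\theta$, and they are the only ones; (iii) for all $\theta \in J(2,30)$, the pairs $(2,30)$ and $(3,5)$ are best 2-term underapproximation sequences of $\theta$, and they are the only ones; (iv) for all $\theta \in (1/2, 1]$ with $\theta \notin J(2,6) \cup J(2,12) \cup J(2,30)$, the 2-term greedy underapproximation sequence $(a_1,a_2)$ of $\theta$ is the unique best 2-term underapproximation sequence of $\theta$.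
   Context: For $\theta \in (0,1]$, $U_2(\theta)$ is the set of pairs of integers $(x_1,x_2)$ with $2 \leq x_1 \leq x_2$ and $\frac{1}{x_1} + \frac{1}{x_2} < \theta$, and $u_2(\theta) = \sup\{\frac{1}{x_1}+\frac{1}{x_2} : (x_1,x_2) \in U_2(\theta)\}$. A pair $(x_1,x_2) \in U_2(\theta)$ is a best 2-term (Egyptian) underapproximation sequence of $\theta$ if $\frac{1}{x_1}+\frac{1}{x_2} = u_2(\theta)$; it is the unique best one if no other pair in $U_2(\theta)$ has this property. Let $G(\theta) = \lfloor 1/\theta\rfloor + 1$ (the unique integer $a\ge 2$ with $1/a<\theta\le 1/(a-1)$); the 2-term greedy underapproximation sequence of $\theta$ is $(a_1,a_2)$ with $a_1 = G(\theta)$, $a_2 = G(\theta - 1/a_1)$. For $\theta\in J(2,a_2)$ with $a_2\ge 3$, the 2-term greedy underapproximation sequence of $\theta$ is $(2,a_2)$. -}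

module Defs where

open import Data.Nat as ℕ using (ℕ; zero; suc; _∸_)
open import Data.Integer using (+_)
open import Data.Rational as ℚ using (ℚ; 0ℚ; _/_; _+_; _<_; _≤_)
open import Data.Product using (Σ; ∃; _×_; _,_)
open import Data.Sum using (_⊎_)
open import Data.Empty using (⊥)
open import Relation.Nullary using (¬_)
open import Relation.Binary.PropositionalEquality using (_≡_)

-- Real numbers as (located) Dedekind cuts of ℚ, given by their lower cut L:
-- L q  means  q < θ.
record ℝ : Set₁ where
  field
    L         : ℚ → Set
    inhabited : ∃ λ q → L q
    bounded   : ∃ λ q → ¬ L q
    downward  : ∀ p q → p < q → L q → L p
    rounded   : ∀ q → L q → ∃ λ r → q < r × L r
    located   : ∀ p q → p < q → L p ⊎ ¬ L q
open ℝ public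

_<ℝ_ : ℚ → ℝ → Set
q <ℝ θ = L θ q

_≤ℝ_ : ℝ → ℚ → Set
θ ≤ℝ q = ¬ (q <ℝ θ)

-- unit fraction 1/x (only used for x ≥ 1; inv 0 = 0 is an irrelevant convention)
inv : ℕ → ℚ
inv zero    = 0ℚ
inv (suc n) = + 1 / suc n

U2 : ℝ → ℕ → ℕ → Set
U2 θ x1 x2 = 2 ℕ.≤ x1 × x1 ℕ.≤ x2 × (inv x1 + inv x2) <ℝ θ

-- (x1,x2) is a best 2-term underapproximation: it lies in U₂(θ) and its sum
-- equals u₂(θ) = sup, i.e. it is ≥ every sum from U₂(θ).
Best : ℝ → ℕ → ℕ → Set
Best θ x1 x2 = U2 θ x1 x2 × (∀ y1 y2 → U2 θ y1 y2 → inv y1 + inv y2 ≤ inv x1 + inv x2)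

UniqueBest : ℝ → ℕ → ℕ → Set
UniqueBest θ x1 x2 = Best θ x1 x2 × (∀ y1 y2 → Best θ y1 y2 → y1 ≡ x1 × y2 ≡ x2)

GStep : ℝ → ℚ → ℕ → Set
GStep θ c a = 2 ℕ.≤ a × (inv a + c) <ℝ θ × θ ≤ℝ (inv (a ∸ 1) + c)

Greedy2 : ℝ → ℕ → ℕ → Set
Greedy2 θ a1 a2 = GStep θ 0ℚ a1 × GStep θ (inv a1) a2

InJ2 : ℕ → ℝ → Set
InJ2 a θ = (inv 2 + inv a) <ℝ θ × θ ≤ℝ (inv 2 + inv (a ∸ 1))

-- A pair 2 ≤ y₁ ≤ y₂ with 1/y₁ + 1/y₂ > 1/2 is (2,k), (3,3), (3,4) or (3,5), with sum
-- 1/2 + 1/k for k = k, 6, 12, 30 respectively; every other pair sums to at most 1/2.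
-- As the values 1/2 + 1/k are discrete, for θ ∈ J(2,a) every sum below θ is at most
-- 1/2 + 1/a, which (2,a) attains; so the best pairs are exactly those with sum 1/2 + 1/a.
-- For θ > 1/2 the greedy sequence is (2,a₂) with θ ∈ J(2,a₂).
module Submission where

open import Defs
open import Data.Nat using (ℕ; _≤_)
open import Data.Product using (_×_; _,_)
open import Data.Sum using (_⊎_)
open import Relation.Nullary using (¬_)
open import Relation.Binary.PropositionalEquality using (_≡_)

open import Data.Nat as ℕ using (zero; suc; z≤n; s≤s; _∸_)
import Data.Nat.Properties as ℕ
import Data.Nat.Coprimality as ℕ
import Data.Integer as ℤ
import Data.Integer.Properties as ℤ
open import Data.Rational using (mkℚ; 0ℚ; _+_; _<_; *≤*; *<*)
  renaming (_≤_ to _≤ℚ_)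
open import Data.Rational.Properties
  using (normalize-coprime; positive⁻¹; <⇒≤; <-irrefl; <-≤-trans; ≤-trans; ≤-antisym;
         <-cmp; +-comm; +-identityʳ; +-mono-≤; +-monoʳ-≤; +-monoʳ-<)
open import Data.Product using (∃; proj₁)
open import Data.Sum using (inj₁; inj₂)
open import Data.Empty using (⊥-elim)
open import Relation.Nullary using (yes; no)
open import Relation.Binary.Definitions using (tri<; tri≈; tri>)
open import Relation.Binary.PropositionalEquality using (refl; sym; trans; cong; subst; subst₂)

<⇒≱ : ∀ {p q} → p < q → ¬ (q ≤ℚ p)
<⇒≱ p<q q≤p = <-irrefl refl (<-≤-trans p<q q≤p)

<ℝ-≤ℝ-trans : ∀ θ {p q} → p <ℝ θ → θ ≤ℝ q → p < q
<ℝ-≤ℝ-trans θ {p} {q} p<θ θ≤q with <-cmp p q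
... | tri< p<q _ _ = p<q
... | tri≈ _ refl _ = ⊥-elim (θ≤q p<θ)
... | tri> _ _ q<p = ⊥-elim (θ≤q (downward θ q p q<p p<θ))

inv-suc : ∀ n → inv (suc n) ≡ mkℚ (ℤ.+ 1) n (ℕ.1-coprimeTo (suc n))
inv-suc n = normalize-coprime (ℕ.1-coprimeTo (suc n))

inv-positive : ∀ n → 0ℚ < inv (suc n)
inv-positive n rewrite inv-suc n = positive⁻¹ _

inv-antitone : ∀ {m n} → m ≤ n → inv (suc n) ≤ℚ inv (suc m)
inv-antitone {m} {n} m≤n rewrite inv-suc n | inv-suc m =
  *≤* (subst₂ ℤ._≤_ (sym (ℤ.*-identityˡ _)) (sym (ℤ.*-identityˡ _)) (ℤ.+≤+ (s≤s m≤n)))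

inv-strictlyAntitone : ∀ {m n} → m ℕ.< n → inv (suc n) < inv (suc m)
inv-strictlyAntitone {m} {n} m<n rewrite inv-suc n | inv-suc m =
  *<* (subst₂ ℤ._<_ (sym (ℤ.*-identityˡ _)) (sym (ℤ.*-identityˡ _)) (ℤ.+<+ (s≤s m<n)))

+inv-injective : ∀ p m n → p + inv (suc m) ≡ p + inv (suc n) → m ≡ n
+inv-injective p m n eq with ℕ.<-cmp m n
... | tri< m<n _ _ = ⊥-elim (<-irrefl (sym eq) (+-monoʳ-< p (inv-strictlyAntitone m<n)))
... | tri≈ _ m≡n _ = m≡n
... | tri> _ _ n<m = ⊥-elim (<-irrefl eq (+-monoʳ-< p (inv-strictlyAntitone n<m)))

p<p+inv : ∀ p n → p < p + inv (suc n)
p<p+inv p n = subst (_< p + inv (suc n)) (+-identityʳ p) (+-monoʳ-< p (inv-positive n))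

-- Nothing lies strictly between 1/(n+2) and 1/(n+1).
+inv-<⇒≤ : ∀ p k n → p + inv k < p + inv (suc n) → p + inv k ≤ℚ p + inv (suc (suc n))
+inv-<⇒≤ p zero n _ = +-monoʳ-≤ p (<⇒≤ (inv-positive (suc n)))
+inv-<⇒≤ p (suc k) n lt with suc n ℕ.≤? k
... | yes n<k = +-monoʳ-≤ p (inv-antitone n<k)
... | no n≮k = ⊥-elim (<⇒≱ lt (+-monoʳ-≤ p (inv-antitone (ℕ.≤-pred (ℕ.≰⇒> n≮k)))))

data HalfPlusInv : ℕ → ℕ → ℕ → Set where
  two-k       : ∀ {k} → 2 ≤ k → HalfPlusInv 2 k k
  three-three : HalfPlusInv 3 3 6
  three-four  : HalfPlusInv 3 4 12
  three-five  : HalfPlusInv 3 5 30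

halfPlusInv-sum : ∀ {y1 y2 k} → HalfPlusInv y1 y2 k → inv y1 + inv y2 ≡ inv 2 + inv k
halfPlusInv-sum (two-k _)   = refl
halfPlusInv-sum three-three = refl
halfPlusInv-sum three-four  = refl
halfPlusInv-sum three-five  = refl

halfPlusInv-admissible : ∀ {y1 y2 k} → HalfPlusInv y1 y2 k → 2 ≤ y1 × y1 ≤ y2 × 2 ≤ k
halfPlusInv-admissible (two-k 2≤k) = ℕ.≤-refl , 2≤k , 2≤k
halfPlusInv-admissible three-three = ℕ.m≤m+n 2 1 , ℕ.m≤m+n 3 0 , ℕ.m≤m+n 2 4
halfPlusInv-admissible three-four  = ℕ.m≤m+n 2 1 , ℕ.m≤m+n 3 1 , ℕ.m≤m+n 2 10
halfPlusInv-admissible three-five  = ℕ.m≤m+n 2 1 , ℕ.m≤m+n 3 2 , ℕ.m≤m+n 2 28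

-- The remaining pairs are dominated by (3,6) or (4,4), which both sum to 1/2.
halfPlusInv-or-≤half : ∀ {y1 y2} → 2 ≤ y1 → y1 ≤ y2 →
                       (∃ λ k → HalfPlusInv y1 y2 k) ⊎ inv y1 + inv y2 ≤ℚ inv 2
halfPlusInv-or-≤half {2} {y2} _ 2≤y2 = inj₁ (y2 , two-k 2≤y2)
halfPlusInv-or-≤half {3} {3} _ _ = inj₁ (6 , three-three)
halfPlusInv-or-≤half {3} {4} _ _ = inj₁ (12 , three-four)
halfPlusInv-or-≤half {3} {5} _ _ = inj₁ (30 , three-five)
halfPlusInv-or-≤half {3} {suc (suc (suc (suc (suc (suc n)))))} _ _ =
  inj₂ (+-monoʳ-≤ (inv 3) (inv-antitone (ℕ.m≤m+n 5 n)))
halfPlusInv-or-≤half {suc (suc (suc (suc m)))} _ (s≤s (s≤s (s≤s (s≤s {n = n} _)))) =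
  inj₂ (+-mono-≤ (inv-antitone (ℕ.m≤m+n 3 m)) (inv-antitone (ℕ.m≤m+n 3 n)))
halfPlusInv-or-≤half {1} (s≤s ()) _
halfPlusInv-or-≤half {3} {1} _ (s≤s ())
halfPlusInv-or-≤half {3} {2} _ (s≤s (s≤s ()))

halfPlusInv-index : ∀ {y1 y2 k a} → HalfPlusInv y1 y2 k →
                    inv y1 + inv y2 ≡ inv 2 + inv (suc a) → k ≡ suc a
halfPlusInv-index {a = a} hp eq with halfPlusInv-admissible hp
... | _ , _ , s≤s {n = k} _ = cong suc (+inv-injective (inv 2) k a (trans (sym (halfPlusInv-sum hp)) eq))

U2-sum-≤ : ∀ θ {a y1 y2} → 2 ≤ a → θ ≤ℝ (inv 2 + inv (a ∸ 1)) → U2 θ y1 y2 →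
           inv y1 + inv y2 ≤ℚ inv 2 + inv a
U2-sum-≤ θ (s≤s (s≤s {n = b} _)) θ≤ (2≤y1 , y1≤y2 , sum<θ)
  with halfPlusInv-or-≤half 2≤y1 y1≤y2
... | inj₁ (k , hp) = subst (_≤ℚ _) (sym sum≡) (+inv-<⇒≤ (inv 2) k b (subst (_< _) sum≡ sum<))
  where
  sum≡ = halfPlusInv-sum hp
  sum< = <ℝ-≤ℝ-trans θ sum<θ θ≤
... | inj₂ sum≤half = ≤-trans sum≤half (<⇒≤ (p<p+inv (inv 2) (suc b)))

halfPlusInv⇒best : ∀ θ {a y1 y2} → InJ2 a θ → HalfPlusInv y1 y2 a → Best θ y1 y2
halfPlusInv⇒best θ (lower , upper) hp with halfPlusInv-admissible hp
... | 2≤y1 , y1≤y2 , 2≤a =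
  (2≤y1 , y1≤y2 , subst (_<ℝ θ) (sym sum≡) lower) ,
  λ _ _ u → subst (_ ≤ℚ_) (sym sum≡) (U2-sum-≤ θ 2≤a upper u)
  where sum≡ = halfPlusInv-sum hp

best-sum : ∀ θ {a y1 y2} → 2 ≤ a → InJ2 a θ → Best θ y1 y2 → inv y1 + inv y2 ≡ inv 2 + inv a
best-sum θ 2≤a J@(_ , upper) (u , optimal) =
  ≤-antisym (U2-sum-≤ θ 2≤a upper u) (optimal 2 _ (proj₁ (halfPlusInv⇒best θ J (two-k 2≤a))))

best⇒halfPlusInv : ∀ θ {a y1 y2} → 2 ≤ a → InJ2 a θ → Best θ y1 y2 → HalfPlusInv y1 y2 a
best⇒halfPlusInv θ {y1 = y1} {y2} 2≤a@(s≤s {n = a} _) J best@((2≤y1 , y1≤y2 , _) , _)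
  with halfPlusInv-or-≤half 2≤y1 y1≤y2
... | inj₁ (k , hp) = subst (HalfPlusInv y1 y2) (halfPlusInv-index hp (best-sum θ 2≤a J best)) hp
... | inj₂ sum≤half =
  ⊥-elim (<⇒≱ (p<p+inv (inv 2) a) (subst (_≤ℚ inv 2) (best-sum θ 2≤a J best) sum≤half))

halfPlusInv-two-or-three : ∀ {a b y1 y2} → HalfPlusInv 3 b a → HalfPlusInv y1 y2 a →
                           (y1 ≡ 2 × y2 ≡ a) ⊎ (y1 ≡ 3 × y2 ≡ b)
halfPlusInv-two-or-three _           (two-k _)   = inj₁ (refl , refl)
halfPlusInv-two-or-three three-three three-three = inj₂ (refl , refl)
halfPlusInv-two-or-three three-four  three-four  = inj₂ (refl , refl)
halfPlusInv-two-or-three three-five  three-five  = inj₂ (refl , refl)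

halfPlusInv-two-unless-exceptional : ∀ θ {a y1 y2} → InJ2 a θ →
  ¬ (InJ2 6 θ ⊎ InJ2 12 θ ⊎ InJ2 30 θ) → HalfPlusInv y1 y2 a → y1 ≡ 2 × y2 ≡ a
halfPlusInv-two-unless-exceptional θ J ¬J (two-k _)   = refl , refl
halfPlusInv-two-unless-exceptional θ J ¬J three-three = ⊥-elim (¬J (inj₁ J))
halfPlusInv-two-unless-exceptional θ J ¬J three-four  = ⊥-elim (¬J (inj₂ (inj₁ J)))
halfPlusInv-two-unless-exceptional θ J ¬J three-five  = ⊥-elim (¬J (inj₂ (inj₂ J)))

bests-in-exceptional-J : ∀ θ {a b} → HalfPlusInv 3 b a → InJ2 a θ →
  Best θ 2 a × Best θ 3 b × (∀ y1 y2 → Best θ y1 y2 → (y1 ≡ 2 × y2 ≡ a) ⊎ (y1 ≡ 3 × y2 ≡ b))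
bests-in-exceptional-J θ hp J with halfPlusInv-admissible hp
... | _ , _ , 2≤a =
  halfPlusInv⇒best θ J (two-k 2≤a) , halfPlusInv⇒best θ J hp ,
  λ _ _ best → halfPlusInv-two-or-three hp (best⇒halfPlusInv θ 2≤a J best)

greedy2-of-upperHalf : ∀ θ {a1 a2} → inv 2 <ℝ θ → Greedy2 θ a1 a2 → a1 ≡ 2 × 2 ≤ a2 × InJ2 a2 θ
greedy2-of-upperHalf θ {suc (suc (suc c))} half<θ ((_ , _ , θ≤) , _) =
  ⊥-elim (<⇒≱ (<ℝ-≤ℝ-trans θ half<θ θ≤)
              (subst (_≤ℚ inv 2) (sym (+-identityʳ _)) (inv-antitone (s≤s (z≤n {c})))))
greedy2-of-upperHalf θ {2} {a2} _ (_ , (2≤a2 , lower , upper)) =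
  refl , 2≤a2 ,
  subst (_<ℝ θ) (+-comm (inv a2) (inv 2)) lower , subst (θ ≤ℝ_) (+-comm (inv (a2 ∸ 1)) (inv 2)) upper
greedy2-of-upperHalf θ {1} _ ((s≤s () , _) , _)

greedy2-uniqueBest : ∀ θ {a1 a2} → inv 2 <ℝ θ → ¬ (InJ2 6 θ ⊎ InJ2 12 θ ⊎ InJ2 30 θ) →
                     Greedy2 θ a1 a2 → UniqueBest θ a1 a2
greedy2-uniqueBest θ half<θ ¬J greedy with greedy2-of-upperHalf θ half<θ greedy
... | refl , 2≤a2 , J =
  halfPlusInv⇒best θ J (two-k 2≤a2) ,
  λ _ _ best → halfPlusInv-two-unless-exceptional θ J ¬J (best⇒halfPlusInv θ 2≤a2 J best)

theorem7p1 :
    ((a2 : ℕ) → 3 ≤ a2 → (θ : ℝ) → InJ2 a2 θ → Best θ 2 a2)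
    × ((θ : ℝ) → InJ2 6 θ →
        Best θ 2 6 × Best θ 3 3
        × (∀ y1 y2 → Best θ y1 y2 → (y1 ≡ 2 × y2 ≡ 6) ⊎ (y1 ≡ 3 × y2 ≡ 3)))
    × ((θ : ℝ) → InJ2 12 θ →
        Best θ 2 12 × Best θ 3 4
        × (∀ y1 y2 → Best θ y1 y2 → (y1 ≡ 2 × y2 ≡ 12) ⊎ (y1 ≡ 3 × y2 ≡ 4)))
    × ((θ : ℝ) → InJ2 30 θ →
        Best θ 2 30 × Best θ 3 5
        × (∀ y1 y2 → Best θ y1 y2 → (y1 ≡ 2 × y2 ≡ 30) ⊎ (y1 ≡ 3 × y2 ≡ 5)))
    × ((θ : ℝ) → inv 2 <ℝ θ → θ ≤ℝ inv 1
        → ¬ (InJ2 6 θ ⊎ InJ2 12 θ ⊎ InJ2 30 θ)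
        → ∀ a1 a2 → Greedy2 θ a1 a2 → UniqueBest θ a1 a2)
theorem7p1 =
  (λ a 3≤a θ J → halfPlusInv⇒best θ J (two-k (ℕ.<⇒≤ 3≤a))) ,
  (λ θ → bests-in-exceptional-J θ three-three) ,
  (λ θ → bests-in-exceptional-J θ three-four) ,
  (λ θ → bests-in-exceptional-J θ three-five) ,
  (λ θ half<θ _ ¬J _ _ → greedy2-uniqueBest θ half<θ ¬J)
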